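{- Let $N\ge1$, $p$ a probability mass function on $[N]$ with $p(1)\ge\cdots\ge p(N)$, $0<\epsilon<1/2$, $\bar\epsilon=1-\epsilon$, and assume the $2N$ numbers in $\Pi=\{\epsilon p(k)\}_{k\in[N]}\cup\{\bar\epsilon p(k)\}_{k\in[N]}$ are pairwise distinct. Let $A_{\mathrm{ZZ}}=\{k\in[N]:k\text{ odd}\}$ and let $\sigma^\downarrow:[2N]\to\Pi$ be the bijection with $\sigma^\downarrow(1)>\cdots>\sigma^\downarrow(2N)$. Then $A_{\mathrm{ZZ}}$ and $\sigma^\downarrow$ are posterior-respecting.
   Context: Posterior sets: $\Pi^1_A=\{\bar\epsilon p(k):k\in A\}\cup\{\epsilon p(k):k\notin A\}$, $\Pi^0_A=\{\epsilon p(k):k\in A\}\cup\{\bar\epsilon p(k):k\notin A\}$. $A$ and a bijection $\sigma:[2N]\to\Pi$ are posterior-respecting if $\{\sigma(2k-1),\sigma(2k)\}\not\subseteq\Pi^y_A$ for all $k\in[N]$ and $y\in\{0,1\}$. -}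

module Defs where

open import Level using (Level; _⊔_) renaming (suc to lsuc)
open import Algebra.Bundles using (CommutativeRing)
open import Relation.Binary.Core using (Rel)
open import Relation.Binary.Structures using (IsStrictTotalOrder)
open import Relation.Nullary using (¬_)
open import Relation.Binary.PropositionalEquality using (_≡_)
open import Data.Product using (∃; _×_; _,_)
open import Data.Sum using (_⊎_; inj₁; inj₂)
open import Data.Nat as ℕ using (ℕ; zero; suc)
open import Data.Nat.DivMod using (_%_)
open import Data.Fin as Fin using (Fin; toℕ; combine)

-- The real numbers, abstractly: a complete ordered field.
record CompleteOrderedField (c ℓ : Level) : Set (lsuc (c ⊔ ℓ)) where
  field
    commutativeRing : CommutativeRing c ℓ
  open CommutativeRing commutativeRing public
  field
    _<_                : Rel Carrier ℓ
    isStrictTotalOrder : IsStrictTotalOrder _≈_ _<_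
    +-mono-<           : ∀ {a b} d → a < b → (a + d) < (b + d)
    *-pos              : ∀ {a b} → 0# < a → 0# < b → 0# < (a * b)
    0<1                : 0# < 1#
    inverse            : ∀ a → ¬ (a ≈ 0#) → ∃ λ b → (a * b) ≈ 1#

  _≤_ : Rel Carrier ℓ
  a ≤ b = (a < b) ⊎ (a ≈ b)

  field
    sup : (P : Carrier → Set (c ⊔ ℓ)) → ∃ P → (∃ λ u → ∀ x → P x → x ≤ u) →
          ∃ λ s → (∀ x → P x → x ≤ s) × (∀ u → (∀ x → P x → x ≤ u) → s ≤ u)

module _ {c ℓ} (R : CompleteOrderedField c ℓ) where
  open CompleteOrderedField R

  sumFin : ∀ {N} → (Fin N → Carrier) → Carrier
  sumFin {zero}  f = 0#
  sumFin {suc N} f = f Fin.zero + sumFin (λ k → f (Fin.suc k))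

  -- p is a probability mass function on [N] (index k : Fin N stands for k+1)
  IsPMF : ∀ {N} → (Fin N → Carrier) → Set ℓ
  IsPMF p = (∀ k → 0# ≤ p k) × (sumFin p ≈ 1#)

  NonIncreasing : ∀ {N} → (Fin N → Carrier) → Set ℓ
  NonIncreasing p = ∀ i j → toℕ i ℕ.≤ toℕ j → p j ≤ p i

  piVal : ∀ {N} → Carrier → (Fin N → Carrier) → Fin N ⊎ Fin N → Carrier
  piVal ε p (inj₁ k) = ε * p k
  piVal ε p (inj₂ k) = (1# - ε) * p k

  PairwiseDistinct : ∀ {N} → Carrier → (Fin N → Carrier) → Set ℓ
  PairwiseDistinct ε p = ∀ a b → piVal ε p a ≈ piVal ε p b → a ≡ b

  InΠ : ∀ {N} → Carrier → (Fin N → Carrier) → Carrier → Set ℓ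
  InΠ ε p x = ∃ λ a → x ≈ piVal ε p a

  -- σ : [2N] → Π is a bijection with σ(1) > ⋯ > σ(2N)
  -- (position i : Fin (N * 2) stands for i+1)
  IsDecreasingEnumeration : ∀ {N} → Carrier → (Fin N → Carrier) →
                            (Fin (N ℕ.* 2) → Carrier) → Set ℓ
  IsDecreasingEnumeration ε p σ =
      (∀ i → InΠ ε p (σ i))
    × (∀ i j → σ i ≈ σ j → i ≡ j)
    × (∀ a → ∃ λ i → σ i ≈ piVal ε p a)
    × (∀ i j → toℕ i ℕ.< toℕ j → σ j < σ i)

  -- Posterior sets Π^1_A and Π^0_A, for A ⊆ [N] given as a predicate
  InΠ¹ : ∀ {N} → (Fin N → Set) → Carrier → (Fin N → Carrier) → Carrier → Set ℓ
  InΠ¹ A ε p x = ∃ λ k → (A k × x ≈ ((1# - ε) * p k)) ⊎ (¬ A k × x ≈ (ε * p k))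

  InΠ⁰ : ∀ {N} → (Fin N → Set) → Carrier → (Fin N → Carrier) → Carrier → Set ℓ
  InΠ⁰ A ε p x = ∃ λ k → (A k × x ≈ (ε * p k)) ⊎ (¬ A k × x ≈ ((1# - ε) * p k))

  InΠʸ : ∀ {N} → Fin 2 → (Fin N → Set) → Carrier → (Fin N → Carrier) → Carrier → Set ℓ
  InΠʸ Fin.zero      = InΠ⁰
  InΠʸ (Fin.suc _)   = InΠ¹

  -- A and σ are posterior-respecting: {σ(2k-1), σ(2k)} ⊄ Π^y_A for all k, y.
  -- combine k 0 = position 2k (0-based) ~ 2k+1 (1-based), combine k 1 ~ 2k+2.
  PosteriorRespecting : ∀ {N} → (Fin N → Set) → Carrier → (Fin N → Carrier) →
                        (Fin (N ℕ.* 2) → Carrier) → Set ℓ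
  PosteriorRespecting {N} A ε p σ = ∀ (k : Fin N) (y : Fin 2) →
    ¬ (InΠʸ y A ε p (σ (combine {n = 2} k Fin.zero)) × InΠʸ y A ε p (σ (combine {n = 2} k (Fin.suc Fin.zero))))

-- A_ZZ = {k ∈ [N] : k odd}; 0-based index k stands for k+1, so toℕ k is even.
A-ZZ : ∀ {N} → Fin N → Set
A-ZZ k = toℕ k % 2 ≡ 0

module Submission where

-- Label the elements of Π by Fin N ⊎ Fin N: inj₁ k names ε·p(k), inj₂ k
-- names ε̄·p(k) (0-based indices).  As p is non-increasing and the values
-- are distinct, σ lists each column in order of increasing k, so σ merges
-- two chains: the first t positions carry the first l labels of column 1
-- and the first r of column 2, l + r = t, and the label at position t is
-- the next label of one column (the merge invariant 'Prefix').  For A_ZZ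
-- the posterior class of a label is a parity of its index (inj₁ k ∈ Π¹ iff
-- k odd, inj₂ k ∈ Π¹ iff k even).  After an even prefix the classes at
-- positions 2k and 2k + 1 are the parities of r' and r' + 1, where r' is
-- the column-2 count after position 2k, so they differ.

open import Defs
open import Data.Nat as Nat using (ℕ; zero; suc; _*_; parity)
import Data.Nat.Properties as ℕₚ
open import Data.Nat.DivMod using (_%_)
open import Data.Parity.Base as ℙ using (Parity; 0ℙ; 1ℙ; _⁻¹)
import Data.Parity.Properties as ℙₚ
open import Data.Fin as Fin using (Fin; toℕ; fromℕ<; combine)
open import Data.Fin.Properties using (toℕ-injective; toℕ-fromℕ<; toℕ<n; toℕ-combine)
open import Data.Product using (∃; ∃₂; _,_; proj₁; proj₂)
open import Data.Sum using (_⊎_; inj₁; inj₂; map₂)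
open import Data.Sum.Properties using (inj₁-injective; inj₂-injective)
open import Function using (_∘_)
open import Relation.Nullary using (¬_; contradiction)
open import Relation.Binary.PropositionalEquality
  using (_≡_; _≢_; refl; sym; trans; cong; subst; module ≡-Reasoning)
open import Relation.Binary.Definitions using (tri<; tri≈; tri>)
open import Relation.Binary.Structures using (IsStrictTotalOrder)
import Relation.Binary.Reasoning.Setoid as SetoidReasoning

parity-cancelʳ : ∀ m n → parity m ≡ parity (m Nat.+ n) ℙ.+ parity n
parity-cancelʳ m n = begin
  parity m                              ≡⟨ ℙₚ.+-identityʳ (parity m) ⟨
  parity m ℙ.+ 0ℙ                       ≡⟨ cong (parity m ℙ.+_) (ℙₚ.p+p≡0ℙ (parity n)) ⟨
  parity m ℙ.+ (parity n ℙ.+ parity n)  ≡⟨ ℙₚ.+-assoc (parity m) (parity n) (parity n) ⟨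
  parity m ℙ.+ parity n ℙ.+ parity n    ≡⟨ cong (ℙ._+ parity n) (ℙₚ.+-homo-+ m n) ⟨
  parity (m Nat.+ n) ℙ.+ parity n       ∎
  where open ≡-Reasoning

parity-suc : ∀ n → parity (suc n) ≡ parity n ⁻¹
parity-suc n = ℙₚ.+-homo-+ 1 n

parity-double : ∀ n → parity (2 * n Nat.+ 0) ≡ 0ℙ
parity-double n = trans (cong parity (ℕₚ.+-identityʳ (2 * n))) (ℙₚ.*-homo-* 2 n)

even-parity : ∀ n → n % 2 ≡ 0 → parity n ≡ 0ℙ
even-parity zero          _ = refl
even-parity (suc (suc n)) e = even-parity n e

odd-parity : ∀ n → ¬ n % 2 ≡ 0 → parity n ≡ 1ℙ
odd-parity zero          ¬e = contradiction refl ¬e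
odd-parity (suc zero)    _  = refl
odd-parity (suc (suc n)) ¬e = odd-parity n ¬e

toParity : Fin 2 → Parity
toParity Fin.zero    = 0ℙ
toParity (Fin.suc _) = 1ℙ

Label : ℕ → Set
Label n = Fin n ⊎ Fin n

module _ {n : ℕ} where
  open Nat using (_+_; _<_)

  data _≺_ : Label n → Label n → Set where
    ≺₁ : ∀ {c d} → toℕ c < toℕ d → inj₁ c ≺ inj₁ d
    ≺₂ : ∀ {c d} → toℕ c < toℕ d → inj₂ c ≺ inj₂ d

  Below : ℕ → ℕ → Label n → Set
  Below l r (inj₁ c) = toℕ c < l
  Below l r (inj₂ c) = toℕ c < r

  data Next (l r : ℕ) : Label n → ℕ → ℕ → Set where
    next₁ : ∀ {c} → toℕ c ≡ l → Next l r (inj₁ c) (suc l) r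
    next₂ : ∀ {c} → toℕ c ≡ r → Next l r (inj₂ c) l (suc r)

  index-at-boundary : ∀ {k} (c : Fin n) → ¬ toℕ c < k →
                      (∀ d → toℕ d < toℕ c → toℕ d < k) → toℕ c ≡ k
  index-at-boundary {k} c c≮k below with ℕₚ.<-cmp (toℕ c) k
  ... | tri< c<k _ _ = contradiction c<k c≮k
  ... | tri≈ _ c≡k _ = c≡k
  ... | tri> _ _ k<c = contradiction (below d d<c) (ℕₚ.<-irrefl d≡k)
    where
      k<n : k < n
      k<n = ℕₚ.<-trans k<c (toℕ<n c)
      d : Fin n
      d = fromℕ< k<n
      d≡k : toℕ d ≡ k
      d≡k = toℕ-fromℕ< k<n
      d<c : toℕ d < toℕ c
      d<c = subst (_< toℕ c) (sym d≡k) k<c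

  next-of-boundary : ∀ {l r} (s : Label n) → ¬ Below l r s →
                     (∀ s' → s' ≺ s → Below l r s') → ∃₂ (Next l r s)
  next-of-boundary (inj₁ c) s∉ below =
    _ , _ , next₁ (index-at-boundary c s∉ (λ d d<c → below (inj₁ d) (≺₁ d<c)))
  next-of-boundary (inj₂ c) s∉ below =
    _ , _ , next₂ (index-at-boundary c s∉ (λ d d<c → below (inj₂ d) (≺₂ d<c)))

  next-size : ∀ {l r s l' r'} → Next l r s l' r' → l' + r' ≡ suc (l + r)
  next-size         (next₁ _) = refl
  next-size {l} {r} (next₂ _) = ℕₚ.+-suc l r

  next-below : ∀ {l r s l' r'} → Next l r s l' r' → Below l' r' s
  next-below (next₁ c≡l) = ℕₚ.≤-reflexive (cong suc c≡l)
  next-below (next₂ c≡r) = ℕₚ.≤-reflexive (cong suc c≡r)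

  below-grow : ∀ {l r s l' r'} → Next l r s l' r' → ∀ s' → Below l r s' → Below l' r' s'
  below-grow (next₁ _) (inj₁ _) d<l = ℕₚ.m<n⇒m<1+n d<l
  below-grow (next₁ _) (inj₂ _) d<r = d<r
  below-grow (next₂ _) (inj₁ _) d<l = d<l
  below-grow (next₂ _) (inj₂ _) d<r = ℕₚ.m<n⇒m<1+n d<r

  earlier-or-last : ∀ {k} {c d : Fin n} → toℕ c ≡ k → toℕ d < suc k → toℕ d < k ⊎ d ≡ c
  earlier-or-last c≡k d<1+k =
    map₂ (λ d≡k → toℕ-injective (trans d≡k (sym c≡k))) (ℕₚ.m<1+n⇒m<n∨m≡n d<1+k)

  below-after : ∀ {l r s l' r'} → Next l r s l' r' → ∀ s' → Below l' r' s' → Below l r s' ⊎ s' ≡ s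
  below-after (next₁ c≡l) (inj₁ _) d<l' = map₂ (cong inj₁) (earlier-or-last c≡l d<l')
  below-after (next₁ _)   (inj₂ _) d<r  = inj₁ d<r
  below-after (next₂ _)   (inj₁ _) d<l  = inj₁ d<l
  below-after (next₂ c≡r) (inj₂ _) d<r' = map₂ (cong inj₂) (earlier-or-last c≡r d<r')

  -- The posterior class of a label for A_ZZ: 0ℙ means Π⁰, 1ℙ means Π¹.
  zzClass : Label n → Parity
  zzClass (inj₁ c) = parity (toℕ c)
  zzClass (inj₂ c) = parity (suc (toℕ c))

  next-class-even : ∀ {l r s l' r'} → Next l r s l' r' → parity (l + r) ≡ 0ℙ → zzClass s ≡ parity r'
  next-class-even {l} {r} (next₁ {c} c≡l) even = begin
    parity (toℕ c)              ≡⟨ cong parity c≡l ⟩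
    parity l                    ≡⟨ parity-cancelʳ l r ⟩
    parity (l + r) ℙ.+ parity r ≡⟨ cong (ℙ._+ parity r) even ⟩
    parity r                    ∎
    where open ≡-Reasoning
  next-class-even (next₂ c≡r) _ = cong (parity ∘ suc) c≡r

  next-class-odd : ∀ {l r s l' r'} → Next l r s l' r' → parity (l + r) ≡ 1ℙ → zzClass s ≡ parity (suc r)
  next-class-odd {l} {r} (next₁ {c} c≡l) odd = begin
    parity (toℕ c)              ≡⟨ cong parity c≡l ⟩
    parity l                    ≡⟨ parity-cancelʳ l r ⟩
    parity (l + r) ℙ.+ parity r ≡⟨ cong (ℙ._+ parity r) odd ⟩
    1ℙ ℙ.+ parity r             ≡⟨ ℙₚ.+-homo-+ 1 r ⟨
    parity (suc r)              ∎
    where open ≡-Reasoning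
  next-class-odd (next₂ c≡r) _ = cong (parity ∘ suc) c≡r

module Merge {n m : ℕ} (lab : Fin m → Label n) (pos : Label n → Fin m)
             (lab∘pos : ∀ s → lab (pos s) ≡ s) (pos∘lab : ∀ j → pos (lab j) ≡ j)
             (pos-≺ : ∀ {s s'} → s ≺ s' → toℕ (pos s) Nat.< toℕ (pos s')) where
  open Nat using (_+_; _<_; _≤_)

  record Prefix (t l r : ℕ) : Set where
    field
      size        : l + r ≡ t
      below⇒early : ∀ s → Below l r s → toℕ (pos s) < t
      early⇒below : ∀ s → toℕ (pos s) < t → Below l r s

  prefix-empty : Prefix 0 0 0
  prefix-empty = record
    { size        = refl
    ; below⇒early = λ { (inj₁ _) () ; (inj₂ _) () }
    ; early⇒below = λ _ ()
    }

  module _ {t l r} (P : Prefix t l r) {j : Fin m} (j≡t : toℕ j ≡ t) where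
    open Prefix P

    lab-j-at-t : toℕ (pos (lab j)) ≡ t
    lab-j-at-t = trans (cong toℕ (pos∘lab j)) j≡t

    next-at : ∃₂ (Next l r (lab j))
    next-at = next-of-boundary (lab j) not-below earlier-below
      where
        not-below : ¬ Below l r (lab j)
        not-below b = ℕₚ.<-irrefl lab-j-at-t (below⇒early (lab j) b)
        earlier-below : ∀ s → s ≺ lab j → Below l r s
        earlier-below s s≺ = early⇒below s (subst (toℕ (pos s) <_) lab-j-at-t (pos-≺ s≺))

    prefix-extend : ∀ {l' r'} → Next l r (lab j) l' r' → Prefix (suc t) l' r'
    prefix-extend {l'} {r'} nx = record
      { size        = trans (next-size nx) (cong suc size)
      ; below⇒early = early
      ; early⇒below = below
      }
      where
        early : ∀ s → Below l' r' s → toℕ (pos s) < suc t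
        early s b with below-after nx s b
        ... | inj₁ b₀   = ℕₚ.m<n⇒m<1+n (below⇒early s b₀)
        ... | inj₂ refl = ℕₚ.≤-reflexive (cong suc lab-j-at-t)
        below : ∀ s → toℕ (pos s) < suc t → Below l' r' s
        below s e with ℕₚ.m<1+n⇒m<n∨m≡n e
        ... | inj₁ e₀  = below-grow nx s (early⇒below s e₀)
        ... | inj₂ e≡t = subst (Below l' r') (sym s≡lab-j) (next-below nx)
          where
            s≡lab-j : s ≡ lab j
            s≡lab-j = trans (sym (lab∘pos s)) (cong lab (toℕ-injective (trans e≡t (sym j≡t))))

  prefix-exists : ∀ t → t ≤ m → ∃₂ (Prefix t)
  prefix-exists zero    _   = 0 , 0 , prefix-empty
  prefix-exists (suc t) t<m with prefix-exists t (ℕₚ.<⇒≤ t<m)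
  ... | l , r , P with next-at P (toℕ-fromℕ< t<m)
  ... | l' , r' , nx = l' , r' , prefix-extend P (toℕ-fromℕ< t<m) nx

  classes-alternate : ∀ {t} (j₀ j₁ : Fin m) → toℕ j₀ ≡ t → toℕ j₁ ≡ suc t →
                      parity t ≡ 0ℙ → zzClass (lab j₀) ≢ zzClass (lab j₁)
  classes-alternate {t} j₀ j₁ j₀≡t j₁≡t+1 t-even same
    with prefix-exists t (subst (_≤ m) j₀≡t (ℕₚ.<⇒≤ (toℕ<n j₀)))
  ... | l , r , P with next-at P j₀≡t
  ... | l' , r' , nx₀ with next-at (prefix-extend P j₀≡t nx₀) j₁≡t+1
  ... | _ , _ , nx₁ = ℙₚ.p≢p⁻¹ (parity r') (begin
    parity r'        ≡⟨ next-class-even nx₀ (trans (cong parity (Prefix.size P)) t-even) ⟨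
    zzClass (lab j₀) ≡⟨ same ⟩
    zzClass (lab j₁) ≡⟨ next-class-odd nx₁ (trans (cong parity (Prefix.size P')) t+1-odd) ⟩
    parity (suc r')  ≡⟨ parity-suc r' ⟩
    parity r' ⁻¹     ∎)
    where
      open ≡-Reasoning
      P' : Prefix (suc t) l' r'
      P' = prefix-extend P j₀≡t nx₀
      t+1-odd : parity (suc t) ≡ 1ℙ
      t+1-odd = trans (parity-suc t) (cong _⁻¹ t-even)

module _ {c ℓ} (R : CompleteOrderedField c ℓ) where
  open CompleteOrderedField R
    renaming (_*_ to _·_; _<_ to infix 4 _<_; refl to ≈-refl; sym to ≈-sym; trans to ≈-trans; reflexive to ≈-reflexive)
  open IsStrictTotalOrder isStrictTotalOrder
    using (irrefl; asym; <-respˡ-≈; <-respʳ-≈) renaming (trans to <-trans)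

  x<y⇒0<y-x : ∀ {x y} → x < y → 0# < y - x
  x<y⇒0<y-x {x} x<y = <-respˡ-≈ (-‿inverseʳ x) (+-mono-< (- x) x<y)

  *-monoˡ-< : ∀ {e x y} → 0# < e → x < y → e · x < e · y
  *-monoˡ-< {e} {x} {y} 0<e x<y =
    <-respʳ-≈ e[y-x]+ex≈ey (<-respˡ-≈ (+-identityˡ (e · x)) (+-mono-< (e · x) (*-pos 0<e (x<y⇒0<y-x x<y))))
    where
      open SetoidReasoning setoid
      e[y-x]+ex≈ey : e · (y - x) + e · x ≈ e · y
      e[y-x]+ex≈ey = begin
        e · (y - x) + e · x   ≈⟨ distribˡ e (y - x) x ⟨
        e · ((y + - x) + x)   ≈⟨ *-cong ≈-refl (+-assoc y (- x) x) ⟩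
        e · (y + (- x + x))   ≈⟨ *-cong ≈-refl (+-cong ≈-refl (-‿inverseˡ x)) ⟩
        e · (y + 0#)          ≈⟨ *-cong ≈-refl (+-identityʳ y) ⟩
        e · y                 ∎

  ε̄-positive : ∀ {ε} → 0# < ε → ε + ε < 1# → 0# < 1# - ε
  ε̄-positive {ε} 0<ε 2ε<1 = x<y⇒0<y-x (<-trans ε<2ε 2ε<1)
    where
      ε<2ε : ε < ε + ε
      ε<2ε = <-respˡ-≈ (+-identityˡ ε) (+-mono-< ε 0<ε)

  module Enumeration {n} (p : Fin n → Carrier) (ε : Carrier) (noninc : NonIncreasing R p)
                     (0<ε : 0# < ε) (0<ε̄ : 0# < 1# - ε) (distinct : PairwiseDistinct R ε p)
                     (σ : Fin (n * 2) → Carrier)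
                     (σ-in-Π : ∀ i → InΠ R ε p (σ i))
                     (σ-injective : ∀ i j → σ i ≈ σ j → i ≡ j)
                     (σ-onto : ∀ a → ∃ λ i → σ i ≈ piVal R ε p a)
                     (σ-decreasing : ∀ i j → toℕ i Nat.< toℕ j → σ j < σ i) where

    value : Label n → Carrier
    value = piVal R ε p

    lab : Fin (n * 2) → Label n
    lab i = proj₁ (σ-in-Π i)

    pos : Label n → Fin (n * 2)
    pos s = proj₁ (σ-onto s)

    σ∘pos : ∀ s → σ (pos s) ≈ value s
    σ∘pos s = proj₂ (σ-onto s)

    label-of : ∀ {i s} → σ i ≈ value s → lab i ≡ s
    label-of {i} {s} σi≈ = distinct (lab i) s (≈-trans (≈-sym (proj₂ (σ-in-Π i))) σi≈)

    lab∘pos : ∀ s → lab (pos s) ≡ s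
    lab∘pos s = label-of (σ∘pos s)

    pos∘lab : ∀ i → pos (lab i) ≡ i
    pos∘lab i = σ-injective _ _ (≈-trans (σ∘pos (lab i)) (≈-sym (proj₂ (σ-in-Π i))))

    scaled-decreasing : ∀ {e} {c d : Fin n} → 0# < e → toℕ c Nat.< toℕ d →
                        (e · p c ≈ e · p d → c ≡ d) → e · p d < e · p c
    scaled-decreasing 0<e c<d distinct-cd with noninc _ _ (ℕₚ.<⇒≤ c<d)
    ... | inj₁ pd<pc = *-monoˡ-< 0<e pd<pc
    ... | inj₂ pd≈pc =
      contradiction (cong toℕ (distinct-cd (*-cong ≈-refl (≈-sym pd≈pc)))) (ℕₚ.<⇒≢ c<d)

    value-decreasing : ∀ {s s'} → s ≺ s' → value s' < value s
    value-decreasing (≺₁ c<d) = scaled-decreasing 0<ε c<d (inj₁-injective ∘ distinct _ _)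
    value-decreasing (≺₂ c<d) = scaled-decreasing 0<ε̄ c<d (inj₂-injective ∘ distinct _ _)

    pos-antitone : ∀ {s s'} → value s' < value s → toℕ (pos s) Nat.< toℕ (pos s')
    pos-antitone {s} {s'} v'<v with ℕₚ.<-cmp (toℕ (pos s)) (toℕ (pos s'))
    ... | tri< earlier _ _ = earlier
    ... | tri≈ _ same _ = contradiction v'<v (irrefl v'≈v)
      where
        v'≈v : value s' ≈ value s
        v'≈v = ≈-trans (≈-sym (σ∘pos s'))
                 (≈-trans (≈-reflexive (cong σ (toℕ-injective (sym same)))) (σ∘pos s))
    ... | tri> _ _ later =
      contradiction (<-respʳ-≈ (σ∘pos s') (<-respˡ-≈ (σ∘pos s) (σ-decreasing _ _ later))) (asym v'<v)

    open Merge lab pos lab∘pos pos∘lab (pos-antitone ∘ value-decreasing) public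
      using (classes-alternate)

    class-at : ∀ {i} s → σ i ≈ value s → zzClass (lab i) ≡ zzClass s
    class-at s σi≈ = cong zzClass (label-of {s = s} σi≈)

    class-of-member : ∀ y i → InΠʸ R y A-ZZ ε p (σ i) → zzClass (lab i) ≡ toParity y
    class-of-member Fin.zero    i (k , inj₁ (a , σi≈)) =
      trans (class-at (inj₁ k) σi≈) (even-parity (toℕ k) a)
    class-of-member Fin.zero    i (k , inj₂ (¬a , σi≈)) =
      trans (class-at (inj₂ k) σi≈) (trans (parity-suc (toℕ k)) (cong _⁻¹ (odd-parity (toℕ k) ¬a)))
    class-of-member (Fin.suc _) i (k , inj₁ (a , σi≈)) =
      trans (class-at (inj₂ k) σi≈) (trans (parity-suc (toℕ k)) (cong _⁻¹ (even-parity (toℕ k) a)))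
    class-of-member (Fin.suc _) i (k , inj₂ (¬a , σi≈)) =
      trans (class-at (inj₁ k) σi≈) (odd-parity (toℕ k) ¬a)

lemma7 : ∀ {c ℓ} (R : CompleteOrderedField c ℓ) (N : ℕ) (p : Fin (suc N) → CompleteOrderedField.Carrier R)
         (ε : CompleteOrderedField.Carrier R) →
         IsPMF R p → NonIncreasing R p →
         CompleteOrderedField._<_ R (CompleteOrderedField.0# R) ε →
         CompleteOrderedField._<_ R (CompleteOrderedField._+_ R ε ε) (CompleteOrderedField.1# R) →
         PairwiseDistinct R ε p →
         (σ : Fin (suc N * 2) → CompleteOrderedField.Carrier R) →
         IsDecreasingEnumeration R ε p σ →
         PosteriorRespecting R A-ZZ ε p σ
lemma7 R N p ε _ noninc 0<ε 2ε<1 distinct σ (σ-in-Π , σ-injective , σ-onto , σ-decreasing) k y (m₀ , m₁) =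
  classes-alternate j₀ j₁ (toℕ-combine k Fin.zero) j₁≡t+1 (parity-double (toℕ k))
    (trans (class-of-member y j₀ m₀) (sym (class-of-member y j₁ m₁)))
  where
    open Enumeration R p ε noninc 0<ε (ε̄-positive R 0<ε 2ε<1) distinct
                     σ σ-in-Π σ-injective σ-onto σ-decreasing
    j₀ j₁ : Fin (suc N * 2)
    j₀ = combine k Fin.zero
    j₁ = combine k (Fin.suc Fin.zero)
    j₁≡t+1 : toℕ j₁ ≡ suc (2 * toℕ k Nat.+ 0)
    j₁≡t+1 = trans (toℕ-combine k (Fin.suc Fin.zero)) (ℕₚ.+-suc (2 * toℕ k) 0)
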